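{- Let $\alpha,\beta,\nu$ be compositions with $\ell(\nu)\le\ell(\alpha)$ and let $\lambda$ be a partition. Then \[C_{\alpha,\lambda}^{\beta}=C_{\alpha+\nu,\lambda}^{\beta+\nu},\] where $\alpha+\nu$ and $\beta+\nu$ denote componentwise addition (padding $\nu$ with zeros).
   Context: A composition is a finite sequence of positive integers. For compositions $\alpha,\beta$ with $\ell(\beta)\ge\ell(\alpha)$ and $\beta_i\ge\alpha_i$ for $i\le\ell(\alpha)$ (set $\alpha_i=0$ for $i>\ell(\alpha)$), the skew diagram $\beta/\alpha$ has cells $(i,j)$ with $\alpha_i<j\le\beta_i$ (row $i$ counted from the top). An immaculate tableau of shape $\beta/\alpha$ fills these cells with positive integers so that each row weakly increases left to right and the entries in column $1$ strictly increase from top to bottom. Its content is the vector whose $i$-th entry is the number of entries equal to $i$; its reading word reads rows from top to bottom, each row right to left; it is Yamanouchi if in every prefix of the reading word each letter $j\ge1$ occurs at least as often as $j+1$. $C_{\alpha,\lambda}^\beta$ is the number of Yamanouchi immaculate tableaux of shape $\beta/\alpha$ and content $\lambda$ (zero if $\beta/\alpha$ is not a skew diagram). -}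

module Defs where

open import Data.Nat using (ℕ; zero; suc; _+_; _∸_; _≤_; _≥_; _⊔_; _≡ᵇ_; _≤ᵇ_; _<ᵇ_)
open import Data.Bool using (Bool; true; false; _∧_; if_then_else_)
open import Data.Product using (_×_; _,_)
open import Data.List using (List; []; _∷_; length; map; concat; reverse; foldr; inits; filterᵇ; upTo; _++_)
open import Data.List.Relation.Unary.All using (All)
open import Data.List.Relation.Unary.Linked using (Linked)

allᵇ : {A : Set} → (A → Bool) → List A → Bool
allᵇ p []       = true
allᵇ p (x ∷ xs) = p x ∧ allᵇ p xs

IsComposition : List ℕ → Set
IsComposition = All (λ x → 1 ≤ x)

IsPartition : List ℕ → Set
IsPartition l = IsComposition l × Linked _≥_ l

ℓ : List ℕ → ℕ
ℓ = length

-- 1-based entry, with the convention α_i = 0 for i > ℓ(α) (and for i = 0)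
at : List ℕ → ℕ → ℕ
at []       _             = 0
at (x ∷ xs) zero          = 0
at (x ∷ xs) (suc zero)    = x
at (x ∷ xs) (suc (suc i)) = at xs (suc i)

_⊕_ : List ℕ → List ℕ → List ℕ
[]       ⊕ ys       = ys
(x ∷ xs) ⊕ []       = x ∷ xs
(x ∷ xs) ⊕ (y ∷ ys) = (x + y) ∷ (xs ⊕ ys)

isSkew : List ℕ → List ℕ → Bool
isSkew []       _        = true
isSkew (a ∷ as) []       = false
isSkew (a ∷ as) (b ∷ bs) = (a ≤ᵇ b) ∧ isSkew as bs

rowData : List ℕ → List ℕ → List (ℕ × ℕ)
rowData []       bs       = map (λ b → (0 , b)) bs
rowData (a ∷ as) []       = []
rowData (a ∷ as) (b ∷ bs) = (a , b) ∷ rowData as bs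

-- Fillings.  A filling of β/α is a list of rows (top to bottom); row i
-- lists, from left to right, the entries of cells (i,j), α_i < j ≤ β_i.

Filling : Set
Filling = List (List ℕ)

cnt : ℕ → List ℕ → ℕ
cnt i []       = 0
cnt i (x ∷ xs) = if i ≡ᵇ x then suc (cnt i xs) else cnt i xs

maxL : List ℕ → ℕ
maxL = foldr _⊔_ 0

range1 : ℕ → List ℕ
range1 m = map suc (upTo m)

shapeOK : List (ℕ × ℕ) → Filling → Bool
shapeOK []             []       = true
shapeOK []             (r ∷ rs) = false
shapeOK (_ ∷ _)        []       = false
shapeOK ((a , b) ∷ ds) (r ∷ rs) = (length r ≡ᵇ (b ∸ a)) ∧ shapeOK ds rs

weaklyIncr : List ℕ → Bool
weaklyIncr []           = true
weaklyIncr (x ∷ [])     = true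
weaklyIncr (x ∷ y ∷ ys) = (x ≤ᵇ y) ∧ weaklyIncr (y ∷ ys)

strictlyIncr : List ℕ → Bool
strictlyIncr []           = true
strictlyIncr (x ∷ [])     = true
strictlyIncr (x ∷ y ∷ ys) = (x <ᵇ y) ∧ strictlyIncr (y ∷ ys)

-- entries of column 1, top to bottom: the first entry of each row i with
-- α_i = 0 and β_i ≥ 1
column1 : List (ℕ × ℕ) → Filling → List ℕ
column1 []             _              = []
column1 (_ ∷ _)        []             = []
column1 ((a , b) ∷ ds) ([] ∷ rs)      = column1 ds rs
column1 ((a , b) ∷ ds) ((x ∷ r) ∷ rs) =
  if a ≡ᵇ 0 then x ∷ column1 ds rs else column1 ds rs

entries : Filling → List ℕ
entries = concat

readingWord : Filling → List ℕ
readingWord T = concat (map reverse T)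

contentIs : List ℕ → List ℕ → Bool
contentIs w lam =
  allᵇ (λ x → 1 ≤ᵇ x) w ∧
  allᵇ (λ i → cnt i w ≡ᵇ at lam i) (range1 (length lam ⊔ maxL w))

-- Yamanouchi: in every prefix, #j ≥ #(j+1) for every j ≥ 1
-- (j ranging up to the largest letter suffices: otherwise #(j+1) = 0)
yamanouchi : List ℕ → Bool
yamanouchi w =
  allᵇ (λ p → allᵇ (λ j → cnt (suc j) p ≤ᵇ cnt j p) (range1 (maxL w))) (inits w)

isYIT : List ℕ → List ℕ → List ℕ → Filling → Bool
isYIT α β lam T =
  shapeOK (rowData α β) T ∧
  allᵇ weaklyIncr T ∧
  strictlyIncr (column1 (rowData α β) T) ∧
  contentIs (entries T) lam ∧
  yamanouchi (readingWord T)

-- Enumeration of candidate fillings with entries in [1 .. N].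
-- (Any filling of content λ has entries in [1 .. ℓ(λ)], so taking
-- N = ℓ(λ) loses no tableau.)

words : ℕ → ℕ → List (List ℕ)
words zero    N = [] ∷ []
words (suc k) N = concat (map (λ x → map (x ∷_) (words k N)) (range1 N))

fillings : List (ℕ × ℕ) → ℕ → List Filling
fillings []             N = [] ∷ []
fillings ((a , b) ∷ ds) N =
  concat (map (λ r → map (r ∷_) (fillings ds N)) (words (b ∸ a) N))

C : List ℕ → List ℕ → List ℕ → ℕ
C α β lam =
  if isSkew α β
  then length (filterᵇ (isYIT α β lam) (fillings (rowData α β) (length lam)))
  else 0

-- For i ≤ ℓ(ν) we have α_i ≥ 1, so adding ν_i to both α_i and β_i slides row i of
-- the diagram to the right: its length β_i - α_i is unchanged and it still misses
-- column 1.  Row lengths and the set of rows meeting column 1 are all that the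
-- immaculate and Yamanouchi conditions see of the shape, so β/α and (β+ν)/(α+ν)
-- carry literally the same tableaux.  Skewness is preserved as well: β_i ≥ α_i iff
-- β_i + ν_i ≥ α_i + ν_i, and if ℓ(β) < ℓ(α) then also β + ν is too short at row
-- ℓ(β) + 1 ≤ ℓ(α), because there α_i + ν_i > ν_i.
module Submission where

open import Defs
open import Data.Nat using (ℕ; _≤_; zero; suc; _+_; _∸_; _≡ᵇ_; _≤ᵇ_; _<ᵇ_; s≤s)
open import Data.Nat.Properties using (+-comm; [m+n]∸[m+o]≡n∸o)
open import Data.Bool using (Bool; true; false; T; _∧_; T?)
open import Data.Product using (_×_; _,_)
open import Data.List using (List; []; _∷_; length; filterᵇ)
open import Data.List.Properties using (filter-≐)
open import Data.List.Relation.Unary.All using (_∷_)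
open import Data.List.Relation.Binary.Pointwise using (Pointwise; []; _∷_)
import Data.List.Relation.Binary.Pointwise as Pointwise
open import Function using (_∘_)
open import Relation.Binary.PropositionalEquality
  using (_≡_; _≗_; refl; cong; cong₂; sym; trans; subst)

<ᵇ-suc : ∀ m n → (m <ᵇ suc n) ≡ (m ≤ᵇ n)
<ᵇ-suc zero    n = refl
<ᵇ-suc (suc m) n = refl

+-cancelˡ-≤ᵇ : ∀ n a b → (n + a ≤ᵇ n + b) ≡ (a ≤ᵇ b)
+-cancelˡ-≤ᵇ zero    a b = refl
+-cancelˡ-≤ᵇ (suc n) a b = trans (<ᵇ-suc (n + a) (n + b)) (+-cancelˡ-≤ᵇ n a b)

+-cancelʳ-≤ᵇ : ∀ n a b → (a + n ≤ᵇ b + n) ≡ (a ≤ᵇ b)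
+-cancelʳ-≤ᵇ n a b rewrite +-comm a n | +-comm b n = +-cancelˡ-≤ᵇ n a b

[m+o]∸[n+o]≡m∸n : ∀ m n o → (m + o) ∸ (n + o) ≡ m ∸ n
[m+o]∸[n+o]≡m∸n m n o rewrite +-comm m o | +-comm n o = [m+n]∸[m+o]≡n∸o o m n

∧-elimʳ : ∀ x {y} → (x ∧ y) ≡ true → y ≡ true
∧-elimʳ true y≡true = y≡true

filterᵇ-cong : ∀ {A : Set} {p q : A → Bool} → p ≗ q → filterᵇ p ≗ filterᵇ q
filterᵇ-cong {p = p} {q} p≗q =
  filter-≐ (T? ∘ p) (T? ∘ q) ((λ {x} → subst T (p≗q x)) , (λ {x} → subst T (sym (p≗q x))))

⊕-identityʳ : ∀ xs → xs ⊕ [] ≡ xs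
⊕-identityʳ []       = refl
⊕-identityʳ (x ∷ xs) = refl

SameRow : ℕ × ℕ → ℕ × ℕ → Set
SameRow (a , b) (a′ , b′) = (b ∸ a ≡ b′ ∸ a′) × ((a ≡ᵇ 0) ≡ (a′ ≡ᵇ 0))

SameShape : List (ℕ × ℕ) → List (ℕ × ℕ) → Set
SameShape = Pointwise SameRow

SameShape-refl : ∀ ds → SameShape ds ds
SameShape-refl ds = Pointwise.refl (refl , refl)

fillings-cong : ∀ {ds ds′} N → SameShape ds ds′ → fillings ds N ≡ fillings ds′ N
fillings-cong N []                   = refl
fillings-cong N ((len≡ , _) ∷ ds∼ds′) rewrite len≡ | fillings-cong N ds∼ds′ = refl

shapeOK-cong : ∀ {ds ds′} → SameShape ds ds′ → ∀ T → shapeOK ds T ≡ shapeOK ds′ T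
shapeOK-cong []                   []      = refl
shapeOK-cong []                   (_ ∷ _) = refl
shapeOK-cong (_ ∷ _)              []      = refl
shapeOK-cong ((len≡ , _) ∷ ds∼ds′) (r ∷ T) rewrite len≡ | shapeOK-cong ds∼ds′ T = refl

column1-cong : ∀ {ds ds′} → SameShape ds ds′ → ∀ T → column1 ds T ≡ column1 ds′ T
column1-cong []                     T              = refl
column1-cong (_ ∷ _)                []             = refl
column1-cong (_ ∷ ds∼ds′)           ([] ∷ T)       = column1-cong ds∼ds′ T
column1-cong ((_ , first≡) ∷ ds∼ds′) ((x ∷ r) ∷ T) rewrite first≡ | column1-cong ds∼ds′ T = refl

isYIT-cong : ∀ α β α′ β′ → SameShape (rowData α β) (rowData α′ β′) →
  ∀ lam T → isYIT α β lam T ≡ isYIT α′ β′ lam T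
isYIT-cong _ _ _ _ shape lam T =
  cong₂ (λ ok col → ok ∧ allᵇ weaklyIncr T ∧ strictlyIncr col ∧
                    contentIs (entries T) lam ∧ yamanouchi (readingWord T))
        (shapeOK-cong shape T) (column1-cong shape T)

count-cong : ∀ α β α′ β′ lam → SameShape (rowData α β) (rowData α′ β′) →
  length (filterᵇ (isYIT α β lam) (fillings (rowData α β) (length lam))) ≡
  length (filterᵇ (isYIT α′ β′ lam) (fillings (rowData α′ β′) (length lam)))
count-cong α β α′ β′ lam shape = trans
  (cong length (filterᵇ-cong (isYIT-cong α β α′ β′ shape lam) (fillings (rowData α β) (length lam))))
  (cong (λ Ts → length (filterᵇ (isYIT α′ β′ lam) Ts)) (fillings-cong (length lam) shape))

C-cong : ∀ α β α′ β′ lam → isSkew α β ≡ isSkew α′ β′ →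
  (isSkew α β ≡ true → SameShape (rowData α β) (rowData α′ β′)) →
  C α β lam ≡ C α′ β′ lam
C-cong α β α′ β′ lam skew≡ shape rewrite sym skew≡ with isSkew α β | shape
... | false | _     = refl
... | true  | shape = count-cong α β α′ β′ lam (shape refl)

isSkew-⊕ : ∀ α β ν → IsComposition α → ℓ ν ≤ ℓ α → isSkew α β ≡ isSkew (α ⊕ ν) (β ⊕ ν)
isSkew-⊕ α            β        []       _        _       rewrite ⊕-identityʳ α | ⊕-identityʳ β = refl
isSkew-⊕ (suc a ∷ as) []       (n ∷ ns) _        _       rewrite +-cancelʳ-≤ᵇ n (suc a) 0 = refl
isSkew-⊕ (a ∷ as)     (b ∷ bs) (n ∷ ns) (_ ∷ cα) (s≤s l) =
  cong₂ _∧_ (sym (+-cancelʳ-≤ᵇ n a b)) (isSkew-⊕ as bs ns cα l)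

rowData-⊕ : ∀ α β ν → IsComposition α → ℓ ν ≤ ℓ α → isSkew α β ≡ true →
  SameShape (rowData α β) (rowData (α ⊕ ν) (β ⊕ ν))
rowData-⊕ α            β        []       _        _       _    rewrite ⊕-identityʳ α | ⊕-identityʳ β =
  SameShape-refl (rowData α β)
rowData-⊕ (suc a ∷ as) (b ∷ bs) (n ∷ ns) (_ ∷ cα) (s≤s l) skew =
  (sym ([m+o]∸[n+o]≡m∸n b (suc a) n) , refl) ∷ rowData-⊕ as bs ns cα l (∧-elimʳ (suc a ≤ᵇ b) skew)

corollary7p5 : (α β ν lam : List ℕ) →
    IsComposition α → IsComposition β → IsComposition ν → IsPartition lam →
    ℓ ν ≤ ℓ α →
    C α β lam ≡ C (α ⊕ ν) (β ⊕ ν) lam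
corollary7p5 α β ν lam cα _ _ _ l =
  C-cong α β (α ⊕ ν) (β ⊕ ν) lam (isSkew-⊕ α β ν cα l) (rowData-⊕ α β ν cα l)
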